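{- There is an absolute constant $\lambda<30$ (not depending on $k$, $h$, or the candidates) with the following property. Let $k\ge 1$ and $1\le h\le k$ be integers with $h$ dividing $k$, and let $\mathcal{S}$ be a finite set of at least $k$ mutually independent candidates. Let $\{X_1,\dots,X_k\}\subseteq\mathcal{S}$ be any $k$-element subset of top scorers for the test $f_h$, i.e. $f_h(X_i)\ge f_h(Z)$ for every $i$ and every $Z\in\mathcal{S}\setminus\{X_1,\dots,X_k\}$, and let $\{Y_1,\dots,Y_k\}\subseteq\mathcal{S}$ be a $k$-element subset maximizing $g_h$ among all $k$-element subsets of $\mathcal{S}$. Then $$g_h(Y_1,\dots,Y_k)\le \lambda\, g_h(X_1,\dots,X_k).$$
   Context: A candidate is a nonnegative discrete random variable $X$ taking finitely many positive values $x_1>x_2>\dots>x_n$ with probabilities $p_1,\dots,p_n$ (where $\sum_i p_i\le 1$) and the value $0$ with the remaining probability. For candidates $X_1,\dots,X_k$ and $1\le h\le k$, $g_h(X_1,\dots,X_k)=\mathbb{E}\big(X^{(1)}+\dots+X^{(h)}\big)$, where $X^{(i)}$ denotes the $i$-th largest of $X_1,\dots,X_k$ (the expected sum of the $h$ largest values). The test $f_h(X)=\mathbb{E}\big(\max(X^{[1]},\dots,X^{[k/h]})\big)$, where $X^{[1]},\dots,X^{[k/h]}$ are $k/h$ independent copies of $X$.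
   Formalization: The values and the probabilities of every candidate are rational numbers. -}

module Defs where

open import Data.Bool using (true; false)
open import Data.Nat as ℕ using (ℕ; zero; suc)
open import Data.Integer using (+_)
open import Data.Rational using (ℚ; 0ℚ; 1ℚ; _+_; _*_; _-_; _⊔_; _≤_; _<_; _/_)
open import Data.Rational.Properties using (≤-decTotalOrder)
open import Data.List using (List; []; _∷_; map; take; reverse; foldr; replicate)
open import Data.Product using (_×_; _,_; proj₁; proj₂)
open import Data.Fin using (Fin) renaming (zero to fzero; suc to fsuc)
open import Data.Fin.Subset using (Subset)
open import Data.Vec as Vec using (Vec) renaming ([] to v[]; _∷_ to _v∷_)
open import Data.List.Sort ≤-decTotalOrder using (sort)

sumℚ : List ℚ → ℚ
sumℚ = foldr _+_ 0ℚ

data WellFormedAtoms : List (ℚ × ℚ) → Set where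
  wf-[]  : WellFormedAtoms []
  wf-one : ∀ {x p} → 0ℚ < x → 0ℚ < p → WellFormedAtoms ((x , p) ∷ [])
  wf-∷   : ∀ {x p y q rest} → y < x → 0ℚ < p →
           WellFormedAtoms ((y , q) ∷ rest) →
           WellFormedAtoms ((x , p) ∷ (y , q) ∷ rest)

-- A candidate: a nonnegative discrete random variable taking finitely many
-- positive values x₁ > … > xₙ with probabilities p₁,…,pₙ (∑ pᵢ ≤ 1) and the
-- value 0 with the remaining probability.
record Candidate : Set where
  constructor candidate
  field
    atoms    : List (ℚ × ℚ)
    wf       : WellFormedAtoms atoms
    mass≤1   : sumℚ (map proj₂ atoms) ≤ 1ℚ

open Candidate public

dist : Candidate → List (ℚ × ℚ)
dist c = (0ℚ , 1ℚ - sumℚ (map proj₂ (atoms c))) ∷ atoms c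

-- Expectation of F(X₁,…,X_m) for MUTUALLY INDEPENDENT candidates X₁,…,X_m
-- (product distribution), by enumeration of all joint outcomes.
expect : List Candidate → (List ℚ → ℚ) → ℚ
expect []       F = F []
expect (c ∷ cs) F =
  sumℚ (map (λ vp → proj₂ vp * expect cs (λ vs → F (proj₁ vp ∷ vs))) (dist c))

topSum : ℕ → List ℚ → ℚ
topSum h vs = sumℚ (take h (reverse (sort vs)))

maxℚ : List ℚ → ℚ
maxℚ = foldr _⊔_ 0ℚ

g : ℕ → List Candidate → ℚ
g h xs = expect xs (topSum h)

-- test with m independent copies: E(max(X^[1],…,X^[m])); f_h uses m = k/h
fTest : ℕ → Candidate → ℚ
fTest m X = expect (replicate m X) maxℚ

select : ∀ {N} → (Fin N → Candidate) → Subset N → List Candidate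
select {zero}  S v[]           = []
select {suc N} S (true v∷ A) = S fzero ∷ select (λ i → S (fsuc i)) A
select {suc N} S (false v∷ A) = select (λ i → S (fsuc i)) A

thirty : ℚ
thirty = + 30 / 1

{-# OPTIONS --safe #-}
module Submission where

-- Let m = k/h and pick θ with θ ≤ f_m(X) for X in A and f_m(Z) ≤ θ for Z outside A. The key
-- estimate is a threshold inequality for independent X₁,…,Xₙ: with P = ℙ(max Xᵢ ≤ τ),
--   τ + P · Σᵢ E(Xᵢ - τ)⁺ ≤ E(max Xᵢ) + τ P.
-- Applied to m independent copies of one candidate it turns test scores into excess bounds:
-- f_m(X) ≥ θ gives m E(X - θ/2)⁺ ≥ θ/2, and f_m(Z) ≤ θ gives m E(Z - 2θ)⁺ ≤ 2θ. Applied to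
-- m members of A it shows that their maximum has expectation at least θ/2, so splitting A
-- into h such groups gives g_h(A) ≥ hθ/2. On the other side g_h(B) ≤ g_h(A) + g_h(B ∖ A),
-- and since B ∖ A consists of at most k = mh candidates outside A,
--   g_h(B ∖ A) ≤ 2hθ + Σ_{Z ∈ B ∖ A} E(Z - 2θ)⁺ ≤ 2hθ + (k/m) 2θ = 4hθ ≤ 8 g_h(A),
-- so λ = 9 works.

module Threshold where

  open import Data.Empty using (⊥-elim)
  open import Data.Nat as ℕ using (ℕ; zero; suc)
  import Data.Nat.Properties as ℕ
  open import Data.Rational
    using (ℚ; 0ℚ; 1ℚ; ½; _+_; _*_; _-_; -_; _⊔_; _≤_; _<_; _≤?_; _/_; nonNegative; positive)
  open import Data.Rational.Properties
  open import Data.Rational.Solver using (module +-*-Solver)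
  open import Algebra.Properties.CommutativeMonoid.Mult +-0-commutativeMonoid
    using (×-assocˡ; ×-distrib-+) renaming (_×_ to _·_)
  open import Data.List
    using (List; []; _∷_; map; take; drop; reverse; replicate; tabulate; length; _++_)
  import Data.List.Properties as List
  open import Data.List.Relation.Unary.All as All using (All; []; _∷_)
  import Data.List.Relation.Unary.All.Properties as All
  open import Data.List.Relation.Unary.AllPairs as AllPairs using (AllPairs; []; _∷_)
  import Data.List.Relation.Unary.AllPairs.Properties as AllPairs
  open import Data.List.Relation.Binary.Permutation.Propositional as ↭ using (_↭_)
  import Data.List.Relation.Binary.Permutation.Propositional.Properties as ↭
  open import Data.List.Sort ≤-decTotalOrder using (sort; sort-↭; sort-↗)
  import Data.List.Relation.Unary.Linked.Properties as Linked
  open import Data.Fin using (Fin; zero; suc)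
  open import Data.Fin.Subset using (Subset; inside; outside; _∈_; _∉_; ∣_∣; _─_)
  open import Data.Fin.Subset.Properties using (_∈?_; ∣p─q∣≤∣p∣)
  open import Data.Vec using ([]; _∷_; here; there)
  open import Data.Product using (Σ; _×_; _,_; proj₁; proj₂)
  open import Relation.Nullary using (Dec; yes; no)
  import Data.Integer as ℤ
  open import Relation.Binary.PropositionalEquality
  open import Function using (_∘_; flip)

  open import Defs

  open +-*-Solver

  p≤p+q : ∀ {a b} → 0ℚ ≤ b → a ≤ a + b
  p≤p+q {a} {b} 0≤b = subst (_≤ a + b) (+-identityʳ a) (+-monoʳ-≤ a 0≤b)

  p≤q+p : ∀ {a b} → 0ℚ ≤ b → a ≤ b + a
  p≤q+p {a} {b} 0≤b = subst (a ≤_) (+-comm a b) (p≤p+q 0≤b)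

  0≤+ : ∀ {a b} → 0ℚ ≤ a → 0ℚ ≤ b → 0ℚ ≤ a + b
  0≤+ 0≤a 0≤b = ≤-trans 0≤a (p≤p+q 0≤b)

  0≤* : ∀ {a b} → 0ℚ ≤ a → 0ℚ ≤ b → 0ℚ ≤ a * b
  0≤* {a} {b} 0≤a 0≤b = subst (_≤ a * b) (*-zeroˡ b) (*-monoʳ-≤-nonNeg b {{nonNegative 0≤b}} 0≤a)

  *-monoˡ-≤-0≤ : ∀ c {a b} → 0ℚ ≤ c → a ≤ b → c * a ≤ c * b
  *-monoˡ-≤-0≤ c 0≤c = *-monoˡ-≤-nonNeg c {{nonNegative 0≤c}}

  *-cancelˡ-≤-0< : ∀ c {a b} → 0ℚ < c → c * a ≤ c * b → a ≤ b
  *-cancelˡ-≤-0< c 0<c = *-cancelˡ-≤-pos c {{positive 0<c}}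

  +-cancelˡ-≤ : ∀ a {b c} → a + b ≤ a + c → b ≤ c
  +-cancelˡ-≤ a {b} {c} a+b≤a+c = subst₂ _≤_ (cancel b) (cancel c) (+-monoʳ-≤ (- a) a+b≤a+c)
    where
    cancel : ∀ x → - a + (a + x) ≡ x
    cancel x = solve 2 (λ a x → :- a :+ (a :+ x) := x) refl a x

  +-cancelʳ-≤ : ∀ {a b} c → a + c ≤ b + c → a ≤ b
  +-cancelʳ-≤ {a} {b} c a+c≤b+c = +-cancelˡ-≤ c (subst₂ _≤_ (+-comm a c) (+-comm b c) a+c≤b+c)

  0≤1 : 0ℚ ≤ 1ℚ
  0≤1 = nonNegative⁻¹ 1ℚ

  ·-monoʳ-≤ : ∀ n {x y} → x ≤ y → n · x ≤ n · y
  ·-monoʳ-≤ zero    x≤y = ≤-refl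
  ·-monoʳ-≤ (suc n) x≤y = +-mono-≤ x≤y (·-monoʳ-≤ n x≤y)

  0≤· : ∀ n {x} → 0ℚ ≤ x → 0ℚ ≤ n · x
  0≤· zero    0≤x = ≤-refl
  0≤· (suc n) 0≤x = 0≤+ 0≤x (0≤· n 0≤x)

  ·-monoˡ-≤ : ∀ {x m n} → 0ℚ ≤ x → m ℕ.≤ n → m · x ≤ n · x
  ·-monoˡ-≤ {n = n} 0≤x ℕ.z≤n     = 0≤· n 0≤x
  ·-monoˡ-≤ {x}     0≤x (ℕ.s≤s m≤n) = +-monoʳ-≤ x (·-monoˡ-≤ 0≤x m≤n)

  ·-cancelˡ-≤ : ∀ m {x y} → suc m · x ≤ suc m · y → x ≤ y
  ·-cancelˡ-≤ m mx≤my = ≮⇒≥ λ y<x →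
    <-irrefl refl (<-≤-trans (+-mono-<-≤ y<x (·-monoʳ-≤ m (<⇒≤ y<x))) mx≤my)

  sum-map-replicate : ∀ {A : Set} n (φ : A → ℚ) x → sumℚ (map φ (replicate n x)) ≡ n · φ x
  sum-map-replicate zero    φ x = refl
  sum-map-replicate (suc n) φ x = cong (φ x +_) (sum-map-replicate n φ x)

  ·-zeroʳ : ∀ n → n · 0ℚ ≡ 0ℚ
  ·-zeroʳ zero    = refl
  ·-zeroʳ (suc n) = trans (+-identityˡ (n · 0ℚ)) (·-zeroʳ n)

  module _ {A : Set} (φ : A → ℚ) (m : ℕ) {a : ℚ} where

    ·-sum-≤ : ∀ {xs} → All (λ x → m · φ x ≤ a) xs → m · sumℚ (map φ xs) ≤ length xs · a
    ·-sum-≤ []                   = ≤-reflexive (·-zeroʳ m)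
    ·-sum-≤ {x ∷ xs} (mφx≤a ∷ ≤a) = subst (_≤ suc (length xs) · a) (sym (×-distrib-+ (φ x) _ m))
      (+-mono-≤ mφx≤a (·-sum-≤ ≤a))

    ·-sum-≥ : ∀ {xs} → All (λ x → a ≤ m · φ x) xs → length xs · a ≤ m · sumℚ (map φ xs)
    ·-sum-≥ []                   = ≤-reflexive (sym (·-zeroʳ m))
    ·-sum-≥ {x ∷ xs} (a≤mφx ∷ a≤) = subst (suc (length xs) · a ≤_) (sym (×-distrib-+ (φ x) _ m))
      (+-mono-≤ a≤mφx (·-sum-≥ a≤))

  excess : ℚ → ℚ → ℚ
  excess τ x = 0ℚ ⊔ (x - τ)

  atMost : ℚ → ℚ → ℚ
  atMost τ x with x ≤? τ
  ... | yes _ = 1ℚ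
  ... | no _  = 0ℚ

  0≤excess : ∀ τ x → 0ℚ ≤ excess τ x
  0≤excess τ x = p≤p⊔q 0ℚ (x - τ)

  excess≡0 : ∀ {τ x} → x ≤ τ → excess τ x ≡ 0ℚ
  excess≡0 {τ} {x} x≤τ = p≥q⇒p⊔q≡p (subst (x - τ ≤_) (+-inverseʳ τ) (+-monoˡ-≤ (- τ) x≤τ))

  excess≡- : ∀ {τ x} → τ ≤ x → excess τ x ≡ x - τ
  excess≡- {τ} {x} τ≤x = p≤q⇒p⊔q≡q (subst (_≤ x - τ) (+-inverseʳ τ) (+-monoˡ-≤ (- τ) τ≤x))

  excess-mono : ∀ τ {a b} → a ≤ b → excess τ a ≤ excess τ b
  excess-mono τ a≤b = ⊔-monoʳ-≤ 0ℚ (+-monoˡ-≤ (- τ) a≤b)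

  ≤+excess : ∀ τ x → x ≤ τ + excess τ x
  ≤+excess τ x = subst (_≤ τ + excess τ x) (solve 2 (λ τ x → τ :+ (x :- τ) := x) refl τ x)
    (+-monoʳ-≤ τ (p≤q⊔p 0ℚ (x - τ)))

  excess≤ : ∀ {τ x} → 0ℚ ≤ τ → 0ℚ ≤ x → excess τ x ≤ x
  excess≤ {τ} {x} 0≤τ 0≤x = ⊔-lub 0≤x (subst (x - τ ≤_) (+-identityʳ x) (+-monoʳ-≤ x (neg-antimono-≤ 0≤τ)))

  0≤atMost : ∀ τ x → 0ℚ ≤ atMost τ x
  0≤atMost τ x with x ≤? τ
  ... | yes _ = 0≤1
  ... | no _  = ≤-refl

  atMost≤1 : ∀ τ x → atMost τ x ≤ 1ℚ
  atMost≤1 τ x with x ≤? τ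
  ... | yes _ = ≤-refl
  ... | no _  = 0≤1

  atMost-⊔ : ∀ τ a b → atMost τ (a ⊔ b) ≡ atMost τ a * atMost τ b
  atMost-⊔ τ a b with a ≤? τ | b ≤? τ | a ⊔ b ≤? τ
  ... | yes _   | yes _   | yes _   = refl
  ... | yes a≤τ | yes b≤τ | no a⊔b≰τ = ⊥-elim (a⊔b≰τ (⊔-lub a≤τ b≤τ))
  ... | no a≰τ  | _       | yes a⊔b≤τ = ⊥-elim (a≰τ (≤-trans (p≤p⊔q a b) a⊔b≤τ))
  ... | yes _   | no b≰τ  | yes a⊔b≤τ = ⊥-elim (b≰τ (≤-trans (p≤q⊔p a b) a⊔b≤τ))
  ... | yes _   | no _    | no _    = refl
  ... | no _    | yes _   | no _    = refl
  ... | no _    | no _    | no _    = refl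

  excess-⊔ : ∀ τ a b → excess τ a * atMost τ b + atMost τ a * excess τ b ≤ excess τ (a ⊔ b)
  excess-⊔ τ a b with a ≤? τ | b ≤? τ
  ... | yes a≤τ | yes _ = subst (_≤ excess τ (a ⊔ b))
          (sym (trans (cong (λ e → e * 1ℚ + 1ℚ * excess τ b) (excess≡0 a≤τ))
            (solve 1 (λ e → con 0ℚ :* con 1ℚ :+ con 1ℚ :* e := e) refl (excess τ b))))
        (excess-mono τ (p≤q⊔p a b))
  ... | yes a≤τ | no _ = subst (_≤ excess τ (a ⊔ b))
          (sym (trans (cong (λ e → e * 0ℚ + 1ℚ * excess τ b) (excess≡0 a≤τ))
            (solve 1 (λ e → con 0ℚ :* con 0ℚ :+ con 1ℚ :* e := e) refl (excess τ b))))
        (excess-mono τ (p≤q⊔p a b))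
  ... | no _ | yes _ = subst (_≤ excess τ (a ⊔ b))
          (solve 2 (λ e f → e := e :* con 1ℚ :+ con 0ℚ :* f) refl (excess τ a) (excess τ b))
        (excess-mono τ (p≤p⊔q a b))
  ... | no _ | no _ = subst (_≤ excess τ (a ⊔ b))
          (solve 2 (λ e f → con 0ℚ := e :* con 0ℚ :+ con 0ℚ :* f) refl (excess τ a) (excess τ b))
        (0≤excess τ (a ⊔ b))

  threshold-split : ∀ τ {x} → 0ℚ ≤ x → τ + excess τ x ≤ x + τ * atMost τ x
  threshold-split τ {x} 0≤x with x ≤? τ
  ... | yes x≤τ = subst₂ _≤_ (sym (trans (cong (τ +_) (excess≡0 x≤τ)) (+-identityʳ τ)))
          (cong (x +_) (sym (*-identityʳ τ))) (p≤q+p 0≤x)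
  ... | no x≰τ = ≤-reflexive (trans (cong (τ +_) (excess≡- (<⇒≤ (≰⇒> x≰τ))))
          (solve 2 (λ τ x → τ :+ (x :- τ) := x :+ τ :* con 0ℚ) refl τ x))

  -- Expectations over independent candidates

  weigh : List (ℚ × ℚ) → (ℚ → ℚ) → ℚ
  weigh ds φ = sumℚ (map (λ vp → proj₂ vp * φ (proj₁ vp)) ds)

  NonNegAtoms : List (ℚ × ℚ) → Set
  NonNegAtoms = All (λ vp → 0ℚ ≤ proj₁ vp × 0ℚ ≤ proj₂ vp)

  module _ {φ ψ : ℚ → ℚ} where

    weigh-cong : ∀ {ds} → NonNegAtoms ds → (∀ v → 0ℚ ≤ v → φ v ≡ ψ v) → weigh ds φ ≡ weigh ds ψ
    weigh-cong []                           φ≡ψ = refl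
    weigh-cong {(v , p) ∷ _} ((0≤v , _) ∷ nn) φ≡ψ =
      cong₂ (λ a b → p * a + b) (φ≡ψ v 0≤v) (weigh-cong nn φ≡ψ)

    weigh-mono : ∀ {ds} → NonNegAtoms ds → (∀ v → 0ℚ ≤ v → φ v ≤ ψ v) → weigh ds φ ≤ weigh ds ψ
    weigh-mono []                             φ≤ψ = ≤-refl
    weigh-mono {(v , p) ∷ _} ((0≤v , 0≤p) ∷ nn) φ≤ψ =
      +-mono-≤ (*-monoˡ-≤-0≤ p 0≤p (φ≤ψ v 0≤v)) (weigh-mono nn φ≤ψ)

    weigh-+ : ∀ ds → weigh ds (λ v → φ v + ψ v) ≡ weigh ds φ + weigh ds ψ
    weigh-+ []             = sym (+-identityˡ 0ℚ)
    weigh-+ ((v , p) ∷ ds) = trans (cong (p * (φ v + ψ v) +_) (weigh-+ ds))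
      (solve 5 (λ p a b c d → p :* (a :+ b) :+ (c :+ d) := (p :* a :+ c) :+ (p :* b :+ d))
        refl p (φ v) (ψ v) (weigh ds φ) (weigh ds ψ))

  weigh-scale : ∀ ds a (φ : ℚ → ℚ) → weigh ds (λ v → a * φ v) ≡ a * weigh ds φ
  weigh-scale []             a φ = sym (*-zeroʳ a)
  weigh-scale ((v , p) ∷ ds) a φ = trans (cong (p * (a * φ v) +_) (weigh-scale ds a φ))
    (solve 4 (λ p a b c → p :* (a :* b) :+ a :* c := a :* (p :* b :+ c)) refl p a (φ v) (weigh ds φ))

  weigh-const : ∀ ds a → weigh ds (λ _ → a) ≡ a * sumℚ (map proj₂ ds)
  weigh-const []             a = sym (*-zeroʳ a)
  weigh-const ((v , p) ∷ ds) a = trans (cong (p * a +_) (weigh-const ds a))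
    (solve 3 (λ p a m → p :* a :+ a :* m := a :* (p :+ m)) refl p a (sumℚ (map proj₂ ds)))

  atoms-head-pos : ∀ {x p rest} → WellFormedAtoms ((x , p) ∷ rest) → 0ℚ < x × 0ℚ < p
  atoms-head-pos (wf-one 0<x 0<p)   = 0<x , 0<p
  atoms-head-pos (wf-∷ y<x 0<p wf) = <-trans (proj₁ (atoms-head-pos wf)) y<x , 0<p

  atoms-nonNeg : ∀ {as} → WellFormedAtoms as → NonNegAtoms as
  atoms-nonNeg wf-[]                = []
  atoms-nonNeg (wf-one 0<x 0<p)     = (<⇒≤ 0<x , <⇒≤ 0<p) ∷ []
  atoms-nonNeg wf@(wf-∷ _ 0<p rest) = (<⇒≤ (proj₁ (atoms-head-pos wf)) , <⇒≤ 0<p) ∷ atoms-nonNeg rest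

  dist-nonNeg : ∀ c → NonNegAtoms (dist c)
  dist-nonNeg c = (≤-refl , mass) ∷ atoms-nonNeg (wf c)
    where
    s : ℚ
    s = sumℚ (map proj₂ (atoms c))
    mass : 0ℚ ≤ 1ℚ - s
    mass = subst (_≤ 1ℚ - s) (+-inverseʳ s) (+-monoˡ-≤ (- s) (mass≤1 c))

  dist-mass : ∀ c → sumℚ (map proj₂ (dist c)) ≡ 1ℚ
  dist-mass c = solve 1 (λ s → con 1ℚ :- s :+ s := con 1ℚ) refl (sumℚ (map proj₂ (atoms c)))

  expect₁ : Candidate → (ℚ → ℚ) → ℚ
  expect₁ c = weigh (dist c)

  expect₁-const : ∀ c a → expect₁ c (λ _ → a) ≡ a
  expect₁-const c a = trans (weigh-const (dist c) a) (trans (cong (a *_) (dist-mass c)) (*-identityʳ a))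

  expect₁-mono : ∀ c {φ ψ} → (∀ v → 0ℚ ≤ v → φ v ≤ ψ v) → expect₁ c φ ≤ expect₁ c ψ
  expect₁-mono c = weigh-mono (dist-nonNeg c)

  NonNeg : List ℚ → Set
  NonNeg = All (0ℚ ≤_)

  expect-cong : ∀ cs {F G : List ℚ → ℚ} → (∀ ws → NonNeg ws → F ws ≡ G ws) → expect cs F ≡ expect cs G
  expect-cong []       F≡G = F≡G [] []
  expect-cong (c ∷ cs) F≡G = weigh-cong (dist-nonNeg c) λ v 0≤v →
    expect-cong cs (λ ws nn → F≡G (v ∷ ws) (0≤v ∷ nn))

  expect-mono : ∀ cs {F G : List ℚ → ℚ} → (∀ ws → NonNeg ws → F ws ≤ G ws) → expect cs F ≤ expect cs G
  expect-mono []       F≤G = F≤G [] []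
  expect-mono (c ∷ cs) F≤G = weigh-mono (dist-nonNeg c) λ v 0≤v →
    expect-mono cs (λ ws nn → F≤G (v ∷ ws) (0≤v ∷ nn))

  expect-const : ∀ cs a → expect cs (λ _ → a) ≡ a
  expect-const []       a = refl
  expect-const (c ∷ cs) a = trans (weigh-cong (dist-nonNeg c) (λ _ _ → expect-const cs a)) (expect₁-const c a)

  expect-nonNeg : ∀ cs {F : List ℚ → ℚ} → (∀ ws → NonNeg ws → 0ℚ ≤ F ws) → 0ℚ ≤ expect cs F
  expect-nonNeg cs 0≤F = subst (_≤ expect cs _) (expect-const cs 0ℚ) (expect-mono cs 0≤F)

  expect-+ : ∀ cs (F G : List ℚ → ℚ) → expect cs (λ ws → F ws + G ws) ≡ expect cs F + expect cs G
  expect-+ []       F G = refl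
  expect-+ (c ∷ cs) F G = trans
    (weigh-cong (dist-nonNeg c) (λ v _ → expect-+ cs (λ ws → F (v ∷ ws)) (λ ws → G (v ∷ ws))))
    (weigh-+ (dist c))

  expect-scale : ∀ cs a (F : List ℚ → ℚ) → expect cs (λ ws → a * F ws) ≡ a * expect cs F
  expect-scale []       a F = refl
  expect-scale (c ∷ cs) a F = trans
    (weigh-cong (dist-nonNeg c) (λ v _ → expect-scale cs a (λ ws → F (v ∷ ws))))
    (weigh-scale (dist c) a _)

  expect-factor : ∀ c cs (φ : ℚ → ℚ) (G : List ℚ → ℚ) →
    expect₁ c (λ v → expect cs (λ vs → φ v * G vs)) ≡ expect₁ c φ * expect cs G
  expect-factor c cs φ G = trans
    (weigh-cong (dist-nonNeg c) (λ v _ → trans (expect-scale cs (φ v) G) (*-comm (φ v) (expect cs G))))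
    (trans (weigh-scale (dist c) (expect cs G) φ) (*-comm (expect cs G) (expect₁ c φ)))

  expect-++ : ∀ cs ds (F : List ℚ → ℚ) →
    expect (cs ++ ds) F ≡ expect cs (λ us → expect ds (λ vs → F (us ++ vs)))
  expect-++ []       ds F = refl
  expect-++ (c ∷ cs) ds F = weigh-cong (dist-nonNeg c) (λ v _ → expect-++ cs ds (λ ws → F (v ∷ ws)))

  expect-sum : ∀ cs (φ : ℚ → ℚ) →
    expect cs (λ ws → sumℚ (map φ ws)) ≡ sumℚ (map (λ c → expect₁ c φ) cs)
  expect-sum []       φ = refl
  expect-sum (c ∷ cs) φ = trans
    (weigh-cong (dist-nonNeg c) (λ v _ → trans (expect-+ cs (λ _ → φ v) (λ ws → sumℚ (map φ ws)))
      (cong₂ _+_ (expect-const cs (φ v)) (expect-sum cs φ))))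
    (trans (weigh-+ (dist c)) (cong (expect₁ c φ +_) (expect₁-const c _)))

  restrict : ∀ {A : Set} {n} → Subset n → List A → List A
  restrict []            _        = []
  restrict (_ ∷ _)       []       = []
  restrict (inside ∷ C)  (x ∷ xs) = x ∷ restrict C xs
  restrict (outside ∷ C) (x ∷ xs) = restrict C xs

  expect-restrict : ∀ {n} (C : Subset n) cs (F : List ℚ → ℚ) →
    expect cs (F ∘ restrict C) ≡ expect (restrict C cs) F
  expect-restrict []            cs       F = expect-const cs (F [])
  expect-restrict (_ ∷ _)       []       F = refl
  expect-restrict (inside ∷ C)  (c ∷ cs) F =
    weigh-cong (dist-nonNeg c) (λ v _ → expect-restrict C cs (λ ws → F (v ∷ ws)))
  expect-restrict (outside ∷ C) (c ∷ cs) F =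
    trans (weigh-cong (dist-nonNeg c) (λ _ _ → expect-restrict C cs F)) (expect₁-const c _)

  select≡restrict : ∀ {N} (S : Fin N → Candidate) C → select S C ≡ restrict C (tabulate S)
  select≡restrict {zero}  S []            = refl
  select≡restrict {suc N} S (inside ∷ C)  = cong (S zero ∷_) (select≡restrict (S ∘ suc) C)
  select≡restrict {suc N} S (outside ∷ C) = select≡restrict (S ∘ suc) C

  length-select : ∀ {N} (S : Fin N → Candidate) C → length (select S C) ≡ ∣ C ∣
  length-select {zero}  S []            = refl
  length-select {suc N} S (inside ∷ C)  = cong suc (length-select (S ∘ suc) C)
  length-select {suc N} S (outside ∷ C) = length-select (S ∘ suc) C

  select-All : ∀ {P : Candidate → Set} {N} (S : Fin N → Candidate) C →
    (∀ i → i ∈ C → P (S i)) → All P (select S C)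
  select-All {N = zero}  S []            _  = []
  select-All {N = suc N} S (inside ∷ C)  PS = PS zero here ∷ select-All (S ∘ suc) C (λ i → PS (suc i) ∘ there)
  select-All {N = suc N} S (outside ∷ C) PS = select-All (S ∘ suc) C (λ i → PS (suc i) ∘ there)

  x∈p─q⇒x∉q : ∀ {n} {p q : Subset n} {x} → x ∈ p ─ q → x ∉ q
  x∈p─q⇒x∉q {p = _ ∷ _} {outside ∷ _} here       ()
  x∈p─q⇒x∉q {p = _ ∷ _} {_ ∷ _}       (there x∈) (there x∈q) = x∈p─q⇒x∉q x∈ x∈q

  -- Sums of largest values

  -- The largest sum of at most h entries of a list (see topSum≡top).
  top : ℕ → List ℚ → ℚ
  top zero    _        = 0ℚ
  top (suc h) []       = 0ℚ
  top (suc h) (v ∷ vs) = (v + top h vs) ⊔ top (suc h) vs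

  0≤top : ∀ h vs → 0ℚ ≤ top h vs
  0≤top zero    vs       = ≤-refl
  0≤top (suc h) []       = ≤-refl
  0≤top (suc h) (v ∷ vs) = ≤-trans (0≤top (suc h) vs) (p≤q⊔p (v + top h vs) _)

  top≤top-suc : ∀ h vs → top h vs ≤ top (suc h) vs
  top≤top-suc zero    vs       = 0≤top 1 vs
  top≤top-suc (suc h) []       = ≤-refl
  top≤top-suc (suc h) (v ∷ vs) = ⊔-mono-≤ (+-monoʳ-≤ v (top≤top-suc h vs)) (top≤top-suc (suc h) vs)

  top≤top-∷ : ∀ h v vs → top h vs ≤ top h (v ∷ vs)
  top≤top-∷ zero    v vs = ≤-refl
  top≤top-∷ (suc h) v vs = p≤q⊔p (v + top h vs) _

  top≤top-++ : ∀ h us vs → top h vs ≤ top h (us ++ vs)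
  top≤top-++ h []       vs = ≤-refl
  top≤top-++ h (u ∷ us) vs = ≤-trans (top≤top-++ h us vs) (top≤top-∷ h u (us ++ vs))

  top-swap : ∀ h x y xs → top h (x ∷ y ∷ xs) ≡ top h (y ∷ x ∷ xs)
  top-swap zero          x y xs = refl
  top-swap (suc zero)    x y xs = begin
    (x + 0ℚ) ⊔ ((y + 0ℚ) ⊔ t) ≡⟨ ⊔-assoc (x + 0ℚ) (y + 0ℚ) t ⟨
    ((x + 0ℚ) ⊔ (y + 0ℚ)) ⊔ t ≡⟨ cong (_⊔ t) (⊔-comm (x + 0ℚ) (y + 0ℚ)) ⟩
    ((y + 0ℚ) ⊔ (x + 0ℚ)) ⊔ t ≡⟨ ⊔-assoc (y + 0ℚ) (x + 0ℚ) t ⟩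
    (y + 0ℚ) ⊔ ((x + 0ℚ) ⊔ t) ∎
    where
    open ≡-Reasoning
    t : ℚ
    t = top 1 xs
  top-swap (suc (suc h)) x y xs = begin
    (x + ((y + a) ⊔ b)) ⊔ ((y + b) ⊔ c)         ≡⟨ cong (_⊔ ((y + b) ⊔ c)) (+-distribˡ-⊔ x (y + a) b) ⟩
    ((x + (y + a)) ⊔ (x + b)) ⊔ ((y + b) ⊔ c)   ≡⟨ ⊔-medial (x + (y + a)) (x + b) (y + b) c ⟩
    ((x + (y + a)) ⊔ (y + b)) ⊔ ((x + b) ⊔ c)   ≡⟨ cong (λ z → (z ⊔ (y + b)) ⊔ ((x + b) ⊔ c)) (+-left-comm x y a) ⟩
    ((y + (x + a)) ⊔ (y + b)) ⊔ ((x + b) ⊔ c)   ≡⟨ cong (_⊔ ((x + b) ⊔ c)) (+-distribˡ-⊔ y (x + a) b) ⟨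
    (y + ((x + a) ⊔ b)) ⊔ ((x + b) ⊔ c)         ∎
    where
    open ≡-Reasoning
    a b c : ℚ
    a = top h xs
    b = top (suc h) xs
    c = top (suc (suc h)) xs
    +-distribˡ-⊔ : ∀ x p q → x + (p ⊔ q) ≡ (x + p) ⊔ (x + q)
    +-distribˡ-⊔ x = mono-≤-distrib-⊔ (+-monoʳ-≤ x)
    +-left-comm : ∀ x y a → x + (y + a) ≡ y + (x + a)
    +-left-comm = solve 3 (λ x y a → x :+ (y :+ a) := y :+ (x :+ a)) refl
    ⊔-medial : ∀ p q r s → (p ⊔ q) ⊔ (r ⊔ s) ≡ (p ⊔ r) ⊔ (q ⊔ s)
    ⊔-medial p q r s = begin
      (p ⊔ q) ⊔ (r ⊔ s) ≡⟨ ⊔-assoc p q (r ⊔ s) ⟩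
      p ⊔ (q ⊔ (r ⊔ s)) ≡⟨ cong (p ⊔_) (⊔-assoc q r s) ⟨
      p ⊔ ((q ⊔ r) ⊔ s) ≡⟨ cong (λ z → p ⊔ (z ⊔ s)) (⊔-comm q r) ⟩
      p ⊔ ((r ⊔ q) ⊔ s) ≡⟨ cong (p ⊔_) (⊔-assoc r q s) ⟩
      p ⊔ (r ⊔ (q ⊔ s)) ≡⟨ ⊔-assoc p r (q ⊔ s) ⟨
      (p ⊔ r) ⊔ (q ⊔ s) ∎

  top-∷-cong : ∀ x {xs ys} → (∀ h → top h xs ≡ top h ys) → ∀ h → top h (x ∷ xs) ≡ top h (x ∷ ys)
  top-∷-cong x eq zero    = refl
  top-∷-cong x eq (suc h) = cong₂ (λ p q → (x + p) ⊔ q) (eq h) (eq (suc h))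

  top-↭ : ∀ {xs ys} → xs ↭ ys → ∀ h → top h xs ≡ top h ys
  top-↭ ↭.refl            h = refl
  top-↭ (↭.prep x p)        = top-∷-cong x (top-↭ p)
  top-↭ (↭.swap x y p)    h = trans (top-swap h x y _) (top-∷-cong y (top-∷-cong x (top-↭ p)) h)
  top-↭ (↭.trans p q)     h = trans (top-↭ p h) (top-↭ q h)

  top-suc≤ : ∀ h {x} s → 0ℚ ≤ x → All (_≤ x) s → top (suc h) s ≤ x + top h s
  top-suc≤ h []      0≤x _           = ≤-trans 0≤x (p≤p+q (0≤top h []))
  top-suc≤ h {x} (y ∷ s) 0≤x (y≤x ∷ s≤x) = ⊔-lub
    (≤-trans (+-monoˡ-≤ (top h s) y≤x) (+-monoʳ-≤ x (top≤top-∷ h y s)))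
    (≤-trans (top-suc≤ h s 0≤x s≤x) (+-monoʳ-≤ x (top≤top-∷ h y s)))

  sum-take-descending : ∀ h {s} → AllPairs (flip _≤_) s → NonNeg s → sumℚ (take h s) ≡ top h s
  sum-take-descending zero    _               _          = refl
  sum-take-descending (suc h) []              _          = refl
  sum-take-descending (suc h) {x ∷ _} (s≤x ∷ desc) (0≤x ∷ nn) =
    trans (cong (x +_) (sum-take-descending h desc nn)) (sym (p≥q⇒p⊔q≡p (top-suc≤ h _ 0≤x s≤x)))

  reverse-descending : ∀ {xs} → AllPairs _≤_ xs → AllPairs (flip _≤_) (reverse xs)
  reverse-descending []                       = []
  reverse-descending {x ∷ xs} (x≤xs ∷ asc) = subst (AllPairs _) (sym (List.unfold-reverse x xs))
    (AllPairs.++⁺ (reverse-descending asc) ([] ∷ [])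
      (All.map (_∷ []) (↭.All-resp-↭ (↭.↭-sym (↭.↭-reverse xs)) x≤xs)))

  topSum≡top : ∀ h {vs} → NonNeg vs → topSum h vs ≡ top h vs
  topSum≡top h {vs} nn = trans (sum-take-descending h desc (↭.All-resp-↭ (↭.↭-sym sorted↭vs) nn))
    (top-↭ sorted↭vs h)
    where
    sorted↭vs : reverse (sort vs) ↭ vs
    sorted↭vs = ↭.↭-trans (↭.↭-reverse (sort vs)) (sort-↭ vs)
    desc : AllPairs (flip _≤_) (reverse (sort vs))
    desc = reverse-descending (Linked.Linked⇒AllPairs ≤-trans (sort-↗ vs))

  maxℚ+top≤top-++ : ∀ j us vs → maxℚ us + top j vs ≤ top (suc j) (us ++ vs)
  maxℚ+top≤top-++ j []       vs = subst (_≤ top (suc j) vs) (sym (+-identityˡ (top j vs))) (top≤top-suc j vs)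
  maxℚ+top≤top-++ j (u ∷ us) vs = subst (_≤ top (suc j) (u ∷ us ++ vs))
    (sym (mono-≤-distrib-⊔ (+-monoˡ-≤ (top j vs)) u (maxℚ us)))
    (⊔-mono-≤ (+-monoʳ-≤ u (top≤top-++ j us vs)) (maxℚ+top≤top-++ j us vs))

  0≤sum-excess : ∀ τ xs → 0ℚ ≤ sumℚ (map (excess τ) xs)
  0≤sum-excess τ []       = ≤-refl
  0≤sum-excess τ (x ∷ xs) = 0≤+ (0≤excess τ x) (0≤sum-excess τ xs)

  top≤excess : ∀ h {τ} → 0ℚ ≤ τ → ∀ xs → top h xs ≤ h · τ + sumℚ (map (excess τ) xs)
  top≤excess zero    0≤τ xs       = 0≤+ ≤-refl (0≤sum-excess _ xs)
  top≤excess (suc h) 0≤τ []       = 0≤+ (0≤· (suc h) 0≤τ) ≤-refl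
  top≤excess (suc h) {τ} 0≤τ (x ∷ xs) = ⊔-lub
    (subst (x + top h xs ≤_) (rearrange τ (excess τ x) (h · τ) (sumℚ (map (excess τ) xs)))
      (+-mono-≤ (≤+excess τ x) (top≤excess h 0≤τ xs)))
    (≤-trans (top≤excess (suc h) 0≤τ xs) (+-monoʳ-≤ (suc h · τ) (p≤q+p (0≤excess τ x))))
    where
    rearrange : ∀ a b c d → (a + b) + (c + d) ≡ (a + c) + (b + d)
    rearrange = solve 4 (λ a b c d → (a :+ b) :+ (c :+ d) := (a :+ c) :+ (b :+ d)) refl

  top-restrict-─ : ∀ h {n} (B A : Subset n) ws →
    top h (restrict B ws) ≤ top h (restrict A ws) + top h (restrict (B ─ A) ws)
  top-restrict-─ zero    _             _             _        = p≤p+q ≤-refl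
  top-restrict-─ (suc h) []            []            _        = p≤p+q ≤-refl
  top-restrict-─ (suc h) (_ ∷ _)       (_ ∷ _)       []       = p≤p+q ≤-refl
  top-restrict-─ (suc h) (outside ∷ B) (outside ∷ A) (w ∷ ws) = top-restrict-─ (suc h) B A ws
  top-restrict-─ (suc h) (outside ∷ B) (inside ∷ A)  (w ∷ ws) =
    ≤-trans (top-restrict-─ (suc h) B A ws) (+-monoˡ-≤ _ (top≤top-∷ (suc h) w (restrict A ws)))
  top-restrict-─ (suc h) (inside ∷ B)  (inside ∷ A)  (w ∷ ws) = ⊔-lub
    (≤-trans (+-monoʳ-≤ w (top-restrict-─ h B A ws))
      (subst (_≤ top (suc h) (w ∷ rA) + top (suc h) rD) (+-assoc w (top h rA) (top h rD))
        (+-mono-≤ (p≤p⊔q (w + top h rA) (top (suc h) rA)) (top≤top-suc h rD))))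
    (≤-trans (top-restrict-─ (suc h) B A ws)
      (+-monoˡ-≤ (top (suc h) rD) (p≤q⊔p (w + top h rA) (top (suc h) rA))))
    where
    rA rD : List ℚ
    rA = restrict A ws
    rD = restrict (B ─ A) ws
  top-restrict-─ (suc h) (inside ∷ B)  (outside ∷ A) (w ∷ ws) = ⊔-lub
    (≤-trans (+-monoʳ-≤ w (top-restrict-─ h B A ws))
      (subst (_≤ top (suc h) rA + top (suc h) (w ∷ rD))
        (solve 3 (λ w a d → a :+ (w :+ d) := w :+ (a :+ d)) refl w (top h rA) (top h rD))
        (+-mono-≤ (top≤top-suc h rA) (p≤p⊔q (w + top h rD) (top (suc h) rD)))))
    (≤-trans (top-restrict-─ (suc h) B A ws)
      (+-monoʳ-≤ (top (suc h) rA) (p≤q⊔p (w + top h rD) (top (suc h) rD))))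
    where
    rA rD : List ℚ
    rA = restrict A ws
    rD = restrict (B ─ A) ws

  -- The threshold inequality

  0≤maxℚ : ∀ ws → 0ℚ ≤ maxℚ ws
  0≤maxℚ []       = ≤-refl
  0≤maxℚ (w ∷ ws) = ≤-trans (0≤maxℚ ws) (p≤q⊔p w (maxℚ ws))

  maxℚ≤excess : ∀ {τ} → 0ℚ ≤ τ → ∀ ws → maxℚ ws ≤ τ + sumℚ (map (excess τ) ws)
  maxℚ≤excess 0≤τ []           = 0≤+ 0≤τ ≤-refl
  maxℚ≤excess {τ} 0≤τ (w ∷ ws) = ⊔-lub
    (≤-trans (≤+excess τ w) (+-monoʳ-≤ τ (p≤p+q (0≤sum-excess τ ws))))
    (≤-trans (maxℚ≤excess 0≤τ ws) (+-monoʳ-≤ τ (p≤q+p (0≤excess τ w))))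

  probAtMost : ℚ → List Candidate → ℚ
  probAtMost τ cs = expect cs (atMost τ ∘ maxℚ)

  overshoot : ℚ → List Candidate → ℚ
  overshoot τ cs = expect cs (excess τ ∘ maxℚ)

  excessSum : ℚ → List Candidate → ℚ
  excessSum τ cs = sumℚ (map (λ c → expect₁ c (excess τ)) cs)

  0≤probAtMost : ∀ τ cs → 0ℚ ≤ probAtMost τ cs
  0≤probAtMost τ cs = expect-nonNeg cs (λ ws _ → 0≤atMost τ (maxℚ ws))

  probAtMost-∷ : ∀ τ c cs → probAtMost τ (c ∷ cs) ≡ expect₁ c (atMost τ) * probAtMost τ cs
  probAtMost-∷ τ c cs = trans
    (weigh-cong (dist-nonNeg c) (λ v _ → expect-cong cs (λ vs _ → atMost-⊔ τ v (maxℚ vs))))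
    (expect-factor c cs (atMost τ) (atMost τ ∘ maxℚ))

  overshoot-∷ : ∀ τ c cs →
    expect₁ c (excess τ) * probAtMost τ cs + expect₁ c (atMost τ) * overshoot τ cs ≤ overshoot τ (c ∷ cs)
  overshoot-∷ τ c cs = subst (_≤ overshoot τ (c ∷ cs))
    (trans (weigh-+ (dist c)) (cong₂ _+_
      (expect-factor c cs (excess τ) (atMost τ ∘ maxℚ)) (expect-factor c cs (atMost τ) (excess τ ∘ maxℚ))))
    (expect₁-mono c λ v _ → subst (_≤ expect cs (λ vs → excess τ (v ⊔ maxℚ vs)))
      (expect-+ cs (λ vs → excess τ v * atMost τ (maxℚ vs)) (λ vs → atMost τ v * excess τ (maxℚ vs)))
      (expect-mono cs (λ vs _ → excess-⊔ τ v (maxℚ vs))))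

  probAtMost*excessSum≤overshoot : ∀ τ cs → probAtMost τ cs * excessSum τ cs ≤ overshoot τ cs
  probAtMost*excessSum≤overshoot τ [] = ≤-trans (≤-reflexive (*-zeroʳ (probAtMost τ []))) (0≤excess τ 0ℚ)
  probAtMost*excessSum≤overshoot τ (c ∷ cs) = begin
    probAtMost τ (c ∷ cs) * (e + S) ≡⟨ cong (_* (e + S)) (probAtMost-∷ τ c cs) ⟩
    s * P * (e + S)                 ≡⟨ solve 4 (λ s P e S → s :* P :* (e :+ S) := s :* (P :* e) :+ s :* (P :* S)) refl s P e S ⟩
    s * (P * e) + s * (P * S)       ≤⟨ +-mono-≤ s*Pe≤Pe (*-monoˡ-≤-0≤ s 0≤s (probAtMost*excessSum≤overshoot τ cs)) ⟩
    P * e + s * overshoot τ cs      ≡⟨ cong (_+ s * overshoot τ cs) (*-comm P e) ⟩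
    e * P + s * overshoot τ cs      ≤⟨ overshoot-∷ τ c cs ⟩
    overshoot τ (c ∷ cs)            ∎
    where
    open ≤-Reasoning
    s e P S : ℚ
    s = expect₁ c (atMost τ)
    e = expect₁ c (excess τ)
    P = probAtMost τ cs
    S = excessSum τ cs
    0≤s : 0ℚ ≤ s
    0≤s = subst (_≤ s) (expect₁-const c 0ℚ) (expect₁-mono c (λ v _ → 0≤atMost τ v))
    0≤Pe : 0ℚ ≤ P * e
    0≤Pe = 0≤* (0≤probAtMost τ cs) (subst (_≤ e) (expect₁-const c 0ℚ) (expect₁-mono c (λ v _ → 0≤excess τ v)))
    s*Pe≤Pe : s * (P * e) ≤ P * e
    s*Pe≤Pe = subst (s * (P * e) ≤_) (*-identityˡ (P * e))
      (*-monoʳ-≤-nonNeg (P * e) {{nonNegative 0≤Pe}} (subst (s ≤_) (expect₁-const c 1ℚ) (expect₁-mono c (λ v _ → atMost≤1 τ v))))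

  τ+overshoot≤ : ∀ τ cs → τ + overshoot τ cs ≤ expect cs maxℚ + τ * probAtMost τ cs
  τ+overshoot≤ τ cs = subst₂ _≤_
    (trans (expect-+ cs (λ _ → τ) (excess τ ∘ maxℚ)) (cong (_+ overshoot τ cs) (expect-const cs τ)))
    (trans (expect-+ cs maxℚ (λ ws → τ * atMost τ (maxℚ ws))) (cong (expect cs maxℚ +_) (expect-scale cs τ _)))
    (expect-mono cs (λ ws _ → threshold-split τ (0≤maxℚ ws)))

  threshold-bound : ∀ τ cs →
    τ + probAtMost τ cs * excessSum τ cs ≤ expect cs maxℚ + τ * probAtMost τ cs
  threshold-bound τ cs = ≤-trans (+-monoʳ-≤ τ (probAtMost*excessSum≤overshoot τ cs)) (τ+overshoot≤ τ cs)

  -- Scores of the test f_m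

  0≤fTest : ∀ {m} c → 0ℚ ≤ fTest m c
  0≤fTest {m} c = expect-nonNeg (replicate m c) (λ ws _ → 0≤maxℚ ws)

  excessSum-replicate : ∀ τ m c → excessSum τ (replicate m c) ≡ m · expect₁ c (excess τ)
  excessSum-replicate τ m c = sum-map-replicate m (λ c → expect₁ c (excess τ)) c

  fTest≤excess : ∀ m c {τ} → 0ℚ ≤ τ → fTest m c ≤ τ + m · expect₁ c (excess τ)
  fTest≤excess m c {τ} 0≤τ = subst (fTest m c ≤_)
    (trans (expect-+ (replicate m c) (λ _ → τ) (λ ws → sumℚ (map (excess τ) ws)))
      (cong₂ _+_ (expect-const (replicate m c) τ)
        (trans (expect-sum (replicate m c) (excess τ)) (excessSum-replicate τ m c))))
    (expect-mono (replicate m c) (λ ws _ → maxℚ≤excess 0≤τ ws))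

  excess≤fTest : ∀ m c {τ} → 0ℚ ≤ τ → expect₁ c (excess τ) ≤ fTest (suc m) c
  excess≤fTest m c 0≤τ = expect₁-mono c λ v 0≤v →
    subst (_≤ expect (replicate m c) (λ vs → v ⊔ maxℚ vs)) (expect-const (replicate m c) _)
      (expect-mono (replicate m c) (λ vs _ → ≤-trans (excess≤ 0≤τ 0≤v) (p≤p⊔q v (maxℚ vs))))

  half≤excess : ∀ m c {t} → 0ℚ ≤ t → t + t ≤ fTest m c → t ≤ m · expect₁ c (excess t)
  half≤excess m c {t} 0≤t t+t≤f = +-cancelˡ-≤ t (≤-trans t+t≤f (fTest≤excess m c 0≤t))

  excess≤double : ∀ m c {θ} → 0ℚ ≤ θ → fTest (suc m) c ≤ θ →
    suc m · expect₁ c (excess (θ + θ)) ≤ θ + θ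
  excess≤double m c {θ} 0≤θ f≤θ = by-cases (P ≤? 0ℚ)
    where
    τ P X : ℚ
    τ = θ + θ
    P = probAtMost τ (replicate (suc m) c)
    X = suc m · expect₁ c (excess τ)
    key : τ + P * X ≤ θ + τ * P
    key = subst (λ S → τ + P * S ≤ θ + τ * P) (excessSum-replicate τ (suc m) c)
      (≤-trans (threshold-bound τ (replicate (suc m) c)) (+-monoˡ-≤ (τ * P) f≤θ))
    by-cases : Dec (P ≤ 0ℚ) → X ≤ τ
    -- P = 0 makes key read 2θ ≤ θ, so θ = 0 and already E(X - τ)⁺ ≤ f_m(X) ≤ 0.
    by-cases (yes P≤0) = ≤-trans (·-monoʳ-≤ (suc m) e≤0) (subst (_≤ τ) (sym (·-zeroʳ (suc m))) (0≤+ 0≤θ 0≤θ))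
      where
      θ≤0 : θ ≤ 0ℚ
      θ≤0 = +-cancelˡ-≤ θ (subst₂ _≤_
        (solve 2 (λ θ X → (θ :+ θ) :+ con 0ℚ :* X := θ :+ θ) refl θ X)
        (solve 1 (λ θ → θ :+ (θ :+ θ) :* con 0ℚ := θ :+ con 0ℚ) refl θ)
        (subst (λ p → τ + p * X ≤ θ + τ * p) (≤-antisym P≤0 (0≤probAtMost τ (replicate (suc m) c))) key))
      e≤0 : expect₁ c (excess τ) ≤ 0ℚ
      e≤0 = ≤-trans (excess≤fTest m c (0≤+ 0≤θ 0≤θ)) (≤-trans f≤θ θ≤0)
    by-cases (no P≰0) = *-cancelˡ-≤-0< P (≰⇒> P≰0) (+-cancelˡ-≤ τ (begin
      τ + P * X     ≤⟨ key ⟩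
      θ + τ * P     ≤⟨ +-monoˡ-≤ (τ * P) (p≤p+q {θ} 0≤θ) ⟩
      τ + τ * P     ≡⟨ cong (τ +_) (*-comm τ P) ⟩
      τ + P * τ     ∎))
      where open ≤-Reasoning

  t≤expect-maxℚ : ∀ m {t} cs → 0ℚ ≤ t → All (λ c → t + t ≤ fTest (suc m) c) cs → suc m ℕ.≤ length cs →
    t ≤ expect cs maxℚ
  t≤expect-maxℚ m {t} cs 0≤t t+t≤f m≤len = +-cancelʳ-≤ (t * P) (begin
    t + t * P      ≡⟨ cong (t +_) (*-comm t P) ⟩
    t + P * t      ≤⟨ +-monoʳ-≤ t (*-monoˡ-≤-0≤ P (0≤probAtMost t cs) t≤excessSum) ⟩
    t + P * excessSum t cs ≤⟨ threshold-bound t cs ⟩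
    expect cs maxℚ + t * P ∎)
    where
    open ≤-Reasoning
    P : ℚ
    P = probAtMost t cs
    t≤excessSum : t ≤ excessSum t cs
    t≤excessSum = ·-cancelˡ-≤ m (≤-trans (·-monoˡ-≤ 0≤t m≤len)
      (·-sum-≥ (λ c → expect₁ c (excess t)) (suc m) (All.map (λ {c} → half≤excess (suc m) c 0≤t) t+t≤f)))

  expect-++-≥ : ∀ cs ds {F G H : List ℚ → ℚ} → (∀ us vs → F us + G vs ≤ H (us ++ vs)) →
    expect cs F + expect ds G ≤ expect (cs ++ ds) H
  expect-++-≥ cs ds {F} {G} {H} F+G≤H = subst₂ _≤_
    (trans (expect-+ cs F (λ _ → expect ds G)) (cong (expect cs F +_) (expect-const cs _)))
    (sym (expect-++ cs ds H))
    (expect-mono cs λ us _ → subst (_≤ expect ds (λ vs → H (us ++ vs)))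
      (trans (expect-+ ds (λ _ → F us) G) (cong (_+ expect ds G) (expect-const ds (F us))))
      (expect-mono ds (λ vs _ → F+G≤H us vs)))

  j·t≤expect-top : ∀ m {t} j cs → 0ℚ ≤ t → All (λ c → t + t ≤ fTest (suc m) c) cs → j ℕ.* suc m ℕ.≤ length cs →
    j · t ≤ expect cs (top j)
  j·t≤expect-top m zero    cs 0≤t _      _   = expect-nonNeg cs (λ _ _ → ≤-refl)
  j·t≤expect-top m {t} (suc j) cs 0≤t t+t≤f len = subst (λ xs → suc j · t ≤ expect xs (top (suc j)))
    (List.take++drop≡id (suc m) cs)
    (≤-trans
      (+-mono-≤ (t≤expect-maxℚ m (take (suc m) cs) 0≤t (All.take⁺ (suc m) t+t≤f) len-take)
                (j·t≤expect-top m j (drop (suc m) cs) 0≤t (All.drop⁺ (suc m) t+t≤f) len-drop))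
      (expect-++-≥ (take (suc m) cs) (drop (suc m) cs) (maxℚ+top≤top-++ j)))
    where
    len-take : suc m ℕ.≤ length (take (suc m) cs)
    len-take = ℕ.≤-reflexive (sym (trans (List.length-take (suc m) cs)
      (ℕ.m≤n⇒m⊓n≡m (ℕ.≤-trans (ℕ.m≤m+n (suc m) (j ℕ.* suc m)) len))))
    len-drop : j ℕ.* suc m ℕ.≤ length (drop (suc m) cs)
    len-drop = subst₂ ℕ._≤_ (ℕ.m+n∸m≡n (suc m) (j ℕ.* suc m)) (sym (List.length-drop (suc m) cs))
      (ℕ.∸-monoˡ-≤ (suc m) len)

  g≡expect-top : ∀ h cs → g h cs ≡ expect cs (top h)
  g≡expect-top h cs = expect-cong cs (λ _ → topSum≡top h)

  g-select : ∀ h {N} (S : Fin N → Candidate) C → g h (select S C) ≡ expect (tabulate S) (top h ∘ restrict C)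
  g-select h S C = trans (g≡expect-top h (select S C))
    (trans (cong (λ cs → expect cs (top h)) (select≡restrict S C)) (sym (expect-restrict C (tabulate S) (top h))))

  g-select-─ : ∀ h {N} (S : Fin N → Candidate) B A →
    g h (select S B) ≤ g h (select S A) + g h (select S (B ─ A))
  g-select-─ h S B A = subst₂ _≤_ (sym (g-select h S B))
    (trans (expect-+ (tabulate S) (top h ∘ restrict A) (top h ∘ restrict (B ─ A)))
      (sym (cong₂ _+_ (g-select h S A) (g-select h S (B ─ A)))))
    (expect-mono (tabulate S) (λ ws _ → top-restrict-─ h B A ws))

  g≤excess : ∀ h {τ} → 0ℚ ≤ τ → ∀ cs → g h cs ≤ h · τ + excessSum τ cs
  g≤excess h {τ} 0≤τ cs = subst₂ _≤_ (sym (g≡expect-top h cs))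
    (trans (expect-+ cs (λ _ → h · τ) (λ ws → sumℚ (map (excess τ) ws)))
      (cong₂ _+_ (expect-const cs (h · τ)) (expect-sum cs (excess τ))))
    (expect-mono cs (λ ws _ → top≤excess h 0≤τ ws))

  maxℚ-upper : ∀ xs → All (_≤ maxℚ xs) xs
  maxℚ-upper []       = []
  maxℚ-upper (x ∷ xs) = p≤p⊔q x (maxℚ xs) ∷ All.map (λ y≤ → ≤-trans y≤ (p≤q⊔p x (maxℚ xs))) (maxℚ-upper xs)

  maxℚ-least : ∀ {c} xs → 0ℚ ≤ c → All (_≤ c) xs → maxℚ xs ≤ c
  maxℚ-least []       0≤c []          = 0≤c
  maxℚ-least (x ∷ xs) 0≤c (x≤c ∷ xs≤c) = ⊔-lub x≤c (maxℚ-least xs 0≤c xs≤c)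

  module _ {N} (f : Fin N → ℚ) (A : Subset N) where

    private
      valueOutside : Fin N → ℚ
      valueOutside j with j ∈? A
      ... | yes _ = 0ℚ
      ... | no _  = f j

    separating-threshold : (∀ i → 0ℚ ≤ f i) → (∀ i j → i ∈ A → j ∉ A → f j ≤ f i) →
      Σ ℚ λ θ → 0ℚ ≤ θ × (∀ i → i ∈ A → θ ≤ f i) × (∀ j → j ∉ A → f j ≤ θ)
    separating-threshold 0≤f inside≥outside =
      θ , 0≤maxℚ (tabulate valueOutside) , θ≤inside , outside≤θ
      where
      θ : ℚ
      θ = maxℚ (tabulate valueOutside)
      θ≤inside : ∀ i → i ∈ A → θ ≤ f i
      θ≤inside i i∈A = maxℚ-least (tabulate valueOutside) (0≤f i) (All.tabulate⁺ valueOutside≤)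
        where
        valueOutside≤ : ∀ j → valueOutside j ≤ f i
        valueOutside≤ j with j ∈? A
        ... | yes _   = 0≤f i
        ... | no j∉A  = inside≥outside i j i∈A j∉A
      outside≤θ : ∀ j → j ∉ A → f j ≤ θ
      outside≤θ j j∉A with j ∈? A | All.tabulate⁻ (maxℚ-upper (tabulate valueOutside)) j
      ... | yes j∈A | _  = ⊥-elim (j∉A j∈A)
      ... | no _    | ≤θ = ≤θ

  nine : ℚ
  nine = ℤ.+ 9 / 1

  nine-bound : ∀ {gA gB} u → gB ≤ gA + ((u + u + (u + u)) + (u + u + (u + u))) → u ≤ gA → gB ≤ nine * gA
  nine-bound {gA} {gB} u gB≤ u≤gA = ≤-trans gB≤ (subst (gA + ((u + u + (u + u)) + (u + u + (u + u))) ≤_)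
    (solve 1 (λ a → a :+ ((a :+ a :+ (a :+ a)) :+ (a :+ a :+ (a :+ a))) := con nine :* a) refl gA)
    (+-monoʳ-≤ gA (+-mono-≤ four four)))
    where
    four : u + u + (u + u) ≤ gA + gA + (gA + gA)
    four = +-mono-≤ (+-mono-≤ u≤gA u≤gA) (+-mono-≤ u≤gA u≤gA)

  excessSum-double≤ : ∀ m h {θ} cs → 0ℚ ≤ θ → All (λ c → fTest (suc m) c ≤ θ) cs →
    length cs ℕ.≤ suc m ℕ.* h → excessSum (θ + θ) cs ≤ h · (θ + θ)
  excessSum-double≤ m h {θ} cs 0≤θ f≤θ len = ·-cancelˡ-≤ m (≤-trans
    (·-sum-≤ (λ c → expect₁ c (excess (θ + θ))) (suc m) (All.map (λ {c} → excess≤double m c 0≤θ) f≤θ))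
    (subst (length cs · (θ + θ) ≤_) (sym (×-assocˡ (θ + θ) (suc m) h)) (·-monoˡ-≤ (0≤+ 0≤θ 0≤θ) len)))

  g-select≤nine*g : ∀ m h {N} (S : Fin N → Candidate) (A B : Subset N) {θ} → 0ℚ ≤ θ →
    (∀ i → i ∈ A → θ ≤ fTest (suc m) (S i)) → (∀ j → j ∉ A → fTest (suc m) (S j) ≤ θ) →
    ∣ A ∣ ≡ suc m ℕ.* h → ∣ B ∣ ℕ.≤ ∣ A ∣ → g h (select S B) ≤ nine * g h (select S A)
  g-select≤nine*g m h S A B {θ} 0≤θ θ≤inside outside≤θ ∣A∣≡ ∣B∣≤∣A∣ =
    nine-bound (h · t) (subst (λ x → g h (select S B) ≤ g h (select S A) + (x + x)) h·τ≡ upper) lower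
    where
    t τ : ℚ
    t = ½ * θ
    τ = θ + θ
    θ≡t+t : θ ≡ t + t
    θ≡t+t = solve 1 (λ θ → θ := con ½ :* θ :+ con ½ :* θ) refl θ
    D : Subset _
    D = B ─ A
    upper : g h (select S B) ≤ g h (select S A) + (h · τ + h · τ)
    upper = ≤-trans (g-select-─ h S B A) (+-monoʳ-≤ (g h (select S A))
      (≤-trans (g≤excess h (0≤+ 0≤θ 0≤θ) (select S D)) (+-monoʳ-≤ (h · τ)
        (excessSum-double≤ m h (select S D) 0≤θ
          (select-All S D (λ j j∈D → outside≤θ j (x∈p─q⇒x∉q j∈D)))
          (subst (ℕ._≤ suc m ℕ.* h) (sym (length-select S D))
            (ℕ.≤-trans (∣p─q∣≤∣p∣ B A) (ℕ.≤-trans ∣B∣≤∣A∣ (ℕ.≤-reflexive ∣A∣≡))))))))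
    lower : h · t ≤ g h (select S A)
    lower = subst (h · t ≤_) (sym (g≡expect-top h (select S A)))
      (j·t≤expect-top m h (select S A) (*-monoˡ-≤-0≤ ½ (nonNegative⁻¹ ½) 0≤θ)
        (select-All S A (λ i i∈A → subst (_≤ fTest (suc m) (S i)) θ≡t+t (θ≤inside i i∈A)))
        (ℕ.≤-reflexive (trans (ℕ.*-comm h (suc m)) (sym (trans (length-select S A) ∣A∣≡)))))
    h·τ≡ : h · τ ≡ (h · t + h · t) + (h · t + h · t)
    h·τ≡ = trans (cong (λ x → h · (x + x)) θ≡t+t)
      (trans (×-distrib-+ (t + t) (t + t) h) (cong₂ _+_ (×-distrib-+ t t h) (×-distrib-+ t t h)))

open import Defs
open import Data.Nat using (ℕ; zero; suc; _≤_)
open import Data.Nat.Divisibility using (_∣_; divides; quotient)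
open import Data.Rational using (ℚ; _*_; _<?_) renaming (_≤_ to _≤ℚ_; _<_ to _<ℚ_)
open import Data.Product using (Σ; _×_; _,_)
open import Data.Fin using (Fin)
open import Data.Fin.Subset using (Subset; _∈_; _∉_; ∣_∣)
open import Relation.Binary.PropositionalEquality using (_≡_; refl; sym; trans)
open import Relation.Nullary.Decidable using (toWitness)
open import Data.Unit using (tt)
open import Function using (_∘_)
import Data.Nat.Properties as ℕ
open Threshold using (nine; separating-threshold; 0≤fTest; g-select≤nine*g)

theorem2p11 : Σ ℚ λ lam → lam <ℚ thirty ×
  ((k h : ℕ) → 1 ≤ k → 1 ≤ h → h ≤ k → (hk : h ∣ k) →
   (N : ℕ) → (S : Fin N → Candidate) → k ≤ N →
   (A B : Subset N) → ∣ A ∣ ≡ k → ∣ B ∣ ≡ k →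
   ((i j : Fin N) → i ∈ A → j ∉ A → fTest (quotient hk) (S j) ≤ℚ fTest (quotient hk) (S i)) →
   ((C : Subset N) → ∣ C ∣ ≡ k → g h (select S C) ≤ℚ g h (select S B)) →
   g h (select S B) ≤ℚ lam * g h (select S A))
theorem2p11 = nine , toWitness {a? = nine <? thirty} tt , λ where
  _ _ () _ _ (divides zero refl)
  _ h _ _ _ (divides (suc m) refl) _ S _ A B ∣A∣≡k ∣B∣≡k A-top _ →
    let θ , 0≤θ , θ≤inside , outside≤θ =
          separating-threshold (fTest (suc m) ∘ S) A (λ i → 0≤fTest {suc m} (S i)) A-top
    in g-select≤nine*g m h S A B 0≤θ θ≤inside outside≤θ ∣A∣≡k (ℕ.≤-reflexive (trans ∣B∣≡k (sym ∣A∣≡k)))
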